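{- Let $n$ be a positive integer with $\gcd(n,6)=1$ having at least three distinct prime factors, let $G$ be a cyclic group of order $n$ and $g\in G$ with $\mathrm{ord}(g)=n$. Let $x_1,\dots,x_4\in[1,n-1]$ with $\gcd(n,x_1,x_2,x_3,x_4)=1$ be such that $S=(x_1g)(x_2g)(x_3g)(x_4g)$ is a minimal zero-sum sequence over $G$. Write $f(x_i)=\gcd(n,x_i)$. If $\gcd(f(x_1),f(x_2))=d>1$, then $\mathrm{ind}(S)=1$.
   Context: $G$ is written additively; sequences over $G$ are unordered finite sequences with repetition, written multiplicatively. A minimal zero-sum sequence is one whose terms sum to $0$ and no proper nontrivial subsequence sums to $0$. For a sequence $S=(n_1h)\cdot\ldots\cdot(n_kh)$ with $h$ a generator of $G$ and $1\le n_i\le|G|$, $\|S\|_h=(n_1+\cdots+n_k)/\mathrm{ord}(h)$, and $\mathrm{ind}(S)=\min\{\|S\|_h: \langle h\rangle=G\}$. -}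

module Defs where

open import Data.Nat using (ℕ; zero; suc; _+_; _*_; _≤_; _<_; NonZero)
open import Data.Nat.DivMod using (_%_)
open import Data.Nat.Divisibility using (_∣_)
open import Data.Fin using (Fin; zero; suc)
open import Data.Bool using (Bool; true; false; if_then_else_)
open import Data.Product using (Σ; ∃; _×_; _,_)
open import Relation.Binary.PropositionalEquality using (_≡_)
open import Relation.Nullary using (¬_)

-- Model: the cyclic group G of order n is ℤ/nℤ; an element is represented
-- by a natural number r (standing for r mod n).

sumF : ∀ {k} → (Fin k → ℕ) → ℕ
sumF {zero}  f = 0
sumF {suc k} f = f zero + sumF (λ i → f (suc i))

-- A sequence of length k over ℤ/nℤ, given by representatives s : Fin k → ℕ.
-- A subsequence is selected by a subset of indices I : Fin k → Bool.
subSum : ∀ {k} → (Fin k → Bool) → (Fin k → ℕ) → ℕ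
subSum I s = sumF (λ i → if I i then s i else 0)

ZeroSum : ∀ (n : ℕ) {k} → (Fin k → ℕ) → Set
ZeroSum n s = n ∣ sumF s

MinimalZeroSum : ∀ (n : ℕ) {k} → (Fin k → ℕ) → Set
MinimalZeroSum n {k} s =
  ZeroSum n s ×
  (∀ (I : Fin k → Bool) → (∃ λ i → I i ≡ true) → (∃ λ i → I i ≡ false) →
     ¬ (n ∣ subSum I s))

IsGenerator : (n : ℕ) .{{_ : NonZero n}} → ℕ → Set
IsGenerator n h = h < n × (∀ y → y < n → ∃ λ m → (m * h) % n ≡ y)

IsCoeff : (n : ℕ) .{{_ : NonZero n}} → (h e m : ℕ) → Set
IsCoeff n h e m = 1 ≤ m × m ≤ n × (m * h) % n ≡ e % n

-- ‖s‖_h = N / n, i.e. the coefficients of s w.r.t. h sum to N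
HasNormNumerator : (n : ℕ) .{{_ : NonZero n}} → ∀ {k} → (h : ℕ) → (Fin k → ℕ) → ℕ → Set
HasNormNumerator n {k} h s N =
  Σ (Fin k → ℕ) λ m → (∀ i → IsCoeff n h (s i) (m i)) × sumF m ≡ N

-- ind(s) = 1, i.e. min over generators h of ‖s‖_h equals 1:
-- some generator attains ‖s‖_h = n/n = 1 and every generator has ‖s‖_h ≥ 1.
IndexOne : (n : ℕ) .{{_ : NonZero n}} → ∀ {k} → (Fin k → ℕ) → Set
IndexOne n s =
  (∃ λ h → IsGenerator n h × HasNormNumerator n h s n) ×
  (∀ h N → IsGenerator n h → HasNormNumerator n h s N → n ≤ N)

{-# OPTIONS --safe #-}
-- The coefficients of S with respect to any generator sum to a positive multiple of n, so
-- ind(S) ≥ 1.  Replacing the generator g by w g, for a unit w modulo n with inverse v,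
-- replaces the coefficients x_i by v x_i mod n; for four nonzero residues their sum is n, 2n
-- or 3n, and v ↦ -v exchanges n and 3n, so ind(S) = 1 as soon as some unit v makes the sum
-- differ from 2n.
-- Let p be a prime dividing gcd(n, x₀, x₁); then p ∤ x₂ (else p would divide x₃ as well), and
-- p ≥ 5 as gcd(n, 6) = 1.  Put m = n / p.  Multiplying by 2, 3 and -1 first brings
-- F = x₀ + x₁ mod n into [2n/5, 3n/5].  If the sum is then 2n, a unit 1 + k m fixes the
-- multiples x₀, x₁ of p and moves x₂ into [n - 2m, n) when x₀ + x₁ = F + n, or into [0, 2m)
-- when x₀ + x₁ = F.  Since 2m ≤ 2n/5, either move changes x₂ + x₃, so the new sum is not 2n.
module Submission where

open import Defs
open import Data.Nat
open import Data.Nat.Properties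
open import Data.Nat.DivMod
open import Data.Nat.Divisibility
open import Data.Nat.Coprimality using (Coprime; coprime-Bézout; coprime-divisor)
import Data.Nat.Coprimality as Coprimality
open import Data.Nat.Primality using (Prime; prime⇒irreducible; prime⇒nonZero; prime⇒nonTrivial)
open import Data.Nat.Primality.Factorisation using (factorise)
open import Data.Nat.ListAction using (product)
open import Data.Nat.GCD using (gcd; gcd[m,n]∣m; gcd[m,n]∣n; gcd-greatest; module Bézout)
open import Data.List using ([]; _∷_)
open import Data.List.Relation.Unary.All using (_∷_)
open import Data.Bool using (Bool; true; false)
open import Data.Fin using (Fin; zero; suc; #_)
open import Data.Sum using (_⊎_; inj₁; inj₂; [_,_]′)
open import Data.Product using (∃; _×_; _,_; proj₁; proj₂)
open import Relation.Binary.PropositionalEquality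
open import Relation.Nullary using (¬_; Dec; yes; no)
open import Data.Empty using (⊥-elim)
open import Function using (_∘_; it)
open import Data.Nat.Tactic.RingSolver using (solve-∀)

coprime-*ˡ : ∀ {a b m} → Coprime a m → Coprime b m → Coprime (a * b) m
coprime-*ˡ {a} ca cb {d} (d∣ab , d∣m) = cb (coprime-divisor d⊥a d∣ab , d∣m)
  where
  d⊥a : Coprime d a
  d⊥a (e∣d , e∣a) = ca (e∣a , ∣-trans e∣d d∣m)

sumF-pairs : (z : Fin 4 → ℕ) → sumF z ≡ (z (# 0) + z (# 1)) + (z (# 2) + z (# 3))
sumF-pairs z = regroup (z (# 0)) (z (# 1)) (z (# 2)) (z (# 3))
  where
  regroup : ∀ a b c d → a + (b + (c + (d + 0))) ≡ (a + b) + (c + d)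
  regroup = solve-∀

sumF-cong : ∀ {k} {f g : Fin k → ℕ} → (∀ i → f i ≡ g i) → sumF f ≡ sumF g
sumF-cong {zero}  eq = refl
sumF-cong {suc k} eq = cong₂ _+_ (eq zero) (sumF-cong (λ i → eq (suc i)))

sumF-*ʳ : ∀ {k} (f : Fin k → ℕ) h → sumF (λ i → f i * h) ≡ sumF f * h
sumF-*ʳ {zero}  f h = refl
sumF-*ʳ {suc k} f h = begin
  f zero * h + sumF (λ i → f (suc i) * h) ≡⟨ cong (f zero * h +_) (sumF-*ʳ (λ i → f (suc i)) h) ⟩
  f zero * h + sumF (λ i → f (suc i)) * h ≡⟨ *-distribʳ-+ h (f zero) _ ⟨
  sumF f * h                              ∎
  where open ≡-Reasoning

module Modular (n : ℕ) .{{_ : NonZero n}} where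

  private variable a b c d u v w : ℕ

  infix 4 _≈_
  _≈_ : ℕ → ℕ → Set
  a ≈ b = a % n ≡ b % n

  %-≈ : ∀ a → a % n ≈ a
  %-≈ a = m%n%n≡m%n a n

  ≈-+ : a ≈ b → c ≈ d → a + c ≈ b + d
  ≈-+ {a} {b} {c} {d} a≈b c≈d = begin
    (a + c) % n             ≡⟨ %-distribˡ-+ a c n ⟩
    (a % n + c % n) % n     ≡⟨ cong₂ (λ x y → (x + y) % n) a≈b c≈d ⟩
    (b % n + d % n) % n     ≡⟨ %-distribˡ-+ b d n ⟨
    (b + d) % n             ∎
    where open ≡-Reasoning

  ≈-* : a ≈ b → c ≈ d → a * c ≈ b * d
  ≈-* {a} {b} {c} {d} a≈b c≈d = begin
    (a * c) % n             ≡⟨ %-distribˡ-* a c n ⟩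
    (a % n * (c % n)) % n   ≡⟨ cong₂ (λ x y → (x * y) % n) a≈b c≈d ⟩
    (b % n * (d % n)) % n   ≡⟨ %-distribˡ-* b d n ⟨
    (b * d) % n             ∎
    where open ≡-Reasoning

  ≈-*ˡ : ∀ c → a ≈ b → c * a ≈ c * b
  ≈-*ˡ c = ≈-* {c} refl

  *n≈0 : ∀ a → a * n ≈ 0
  *n≈0 a = trans (m*n%n≡0 a n) (sym (m*n%n≡0 0 n))

  ∣⇒≈0 : n ∣ a → a ≈ 0
  ∣⇒≈0 (divides q refl) = *n≈0 q

  ≈0⇒∣ : a ≈ 0 → n ∣ a
  ≈0⇒∣ {a} a≈0 = m%n≡0⇒n∣m a n (trans a≈0 (m*n%n≡0 0 n))

  ≈⇒≡ : a ≈ b → a < n → b < n → a ≡ b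
  ≈⇒≡ {a} {b} a≈b a<n b<n = trans (sym (m<n⇒m%n≡m a<n)) (trans a≈b (m<n⇒m%n≡m b<n))

  [n∸1]*a+a≡a*n : ∀ a → (n ∸ 1) * a + a ≡ a * n
  [n∸1]*a+a≡a*n a = begin
    (n ∸ 1) * a + a      ≡⟨ cong ((n ∸ 1) * a +_) (*-identityˡ a) ⟨
    (n ∸ 1) * a + 1 * a  ≡⟨ *-distribʳ-+ a (n ∸ 1) 1 ⟨
    (n ∸ 1 + 1) * a      ≡⟨ cong (_* a) (m∸n+n≡m (>-nonZero⁻¹ n)) ⟩
    n * a                ≡⟨ *-comm n a ⟩
    a * n                ∎
    where open ≡-Reasoning

  -- adding (n ∸ 1) * c, a representative of -c, undoes the addition of c
  ≈-cancelʳ-+ : ∀ c → a + c ≈ b + c → a ≈ b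
  ≈-cancelʳ-+ {a} {b} c a+c≈b+c = begin
    a % n                        ≡⟨ [m+kn]%n≡m%n a c n ⟨
    (a + c * n) % n              ≡⟨ cong (_% n) (shift a) ⟩
    (a + c + (n ∸ 1) * c) % n    ≡⟨ ≈-+ a+c≈b+c refl ⟩
    (b + c + (n ∸ 1) * c) % n    ≡⟨ cong (_% n) (shift b) ⟨
    (b + c * n) % n              ≡⟨ [m+kn]%n≡m%n b c n ⟩
    b % n                        ∎
    where
    open ≡-Reasoning
    shift : ∀ x → x + c * n ≡ x + c + (n ∸ 1) * c
    shift x = begin
      x + c * n                ≡⟨ cong (x +_) ([n∸1]*a+a≡a*n c) ⟨
      x + ((n ∸ 1) * c + c)    ≡⟨ +-swap x c (n ∸ 1) ⟩
      x + c + (n ∸ 1) * c      ∎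
      where
      +-swap : ∀ x c k → x + (k * c + c) ≡ x + c + k * c
      +-swap = solve-∀

  1+[n∸1]≈0 : 1 + (n ∸ 1) ≈ 0
  1+[n∸1]≈0 = trans (cong (_% n) (trans (m+[n∸m]≡n (>-nonZero⁻¹ n)) (sym (*-identityˡ n)))) (*n≈0 1)

  [n∸1]*[n∸1]≈1 : (n ∸ 1) * (n ∸ 1) ≈ 1
  [n∸1]*[n∸1]≈1 = ≈-cancelʳ-+ (n ∸ 1) (begin
    ((n ∸ 1) * (n ∸ 1) + (n ∸ 1)) % n  ≡⟨ cong (_% n) ([n∸1]*a+a≡a*n (n ∸ 1)) ⟩
    ((n ∸ 1) * n) % n                  ≡⟨ *n≈0 (n ∸ 1) ⟩
    0 % n                              ≡⟨ 1+[n∸1]≈0 ⟨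
    (1 + (n ∸ 1)) % n                  ∎)
    where open ≡-Reasoning

  record Invertible (v : ℕ) : Set where
    constructor invertible
    field
      inverse   : ℕ
      *-inverse : v * inverse ≈ 1

  invertible-* : Invertible u → Invertible v → Invertible (u * v)
  invertible-* {u} {v} (invertible u⁻¹ uu⁻¹≈1) (invertible v⁻¹ vv⁻¹≈1) = invertible (v⁻¹ * u⁻¹) (begin
    (u * v * (v⁻¹ * u⁻¹)) % n      ≡⟨ cong (_% n) (regroup u v v⁻¹ u⁻¹) ⟩
    (u * (v * v⁻¹ * u⁻¹)) % n      ≡⟨ ≈-*ˡ u (≈-* vv⁻¹≈1 refl) ⟩
    (u * (1 * u⁻¹)) % n            ≡⟨ cong (λ x → (u * x) % n) (*-identityˡ u⁻¹) ⟩
    (u * u⁻¹) % n                  ≡⟨ uu⁻¹≈1 ⟩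
    1 % n                          ∎)
    where
    open ≡-Reasoning
    regroup : ∀ u v v⁻¹ u⁻¹ → u * v * (v⁻¹ * u⁻¹) ≡ u * (v * v⁻¹ * u⁻¹)
    regroup = solve-∀

  invertible-1 : Invertible 1
  invertible-1 = invertible 1 refl

  invertible-n∸1 : Invertible (n ∸ 1)
  invertible-n∸1 = invertible (n ∸ 1) [n∸1]*[n∸1]≈1

  coprime⇒invertible : Coprime v n → Invertible v
  coprime⇒invertible {v} v⊥n with coprime-Bézout v⊥n
  ... | Bézout.+- x y 1+yn≡xv = invertible x (begin
    (v * x) % n        ≡⟨ cong (_% n) (trans (*-comm v x) (sym 1+yn≡xv)) ⟩
    (1 + y * n) % n    ≡⟨ [m+kn]%n≡m%n 1 y n ⟩
    1 % n              ∎)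
    where open ≡-Reasoning
  ... | Bézout.-+ x y 1+xv≡yn = invertible ((n ∸ 1) * x) (≈-cancelʳ-+ (n ∸ 1) (begin
    (v * ((n ∸ 1) * x) + (n ∸ 1)) % n  ≡⟨ cong (_% n) (factor v (n ∸ 1) x) ⟩
    ((n ∸ 1) * (1 + x * v)) % n        ≡⟨ cong (λ z → ((n ∸ 1) * z) % n) 1+xv≡yn ⟩
    ((n ∸ 1) * (y * n)) % n            ≡⟨ cong (_% n) (*-assoc (n ∸ 1) y n) ⟨
    ((n ∸ 1) * y * n) % n              ≡⟨ *n≈0 ((n ∸ 1) * y) ⟩
    0 % n                              ≡⟨ 1+[n∸1]≈0 ⟨
    (1 + (n ∸ 1)) % n                  ∎))
    where
    open ≡-Reasoning
    factor : ∀ v k x → v * (k * x) + k ≡ k * (1 + x * v)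
    factor = solve-∀

  scale : ℕ → ℕ → ℕ
  scale v a = (v * a) % n

  scale-< : ∀ v a → scale v a < n
  scale-< v a = m%n<n (v * a) n

  scale-1 : a < n → scale 1 a ≡ a
  scale-1 {a} a<n = trans (cong (_% n) (*-identityˡ a)) (m<n⇒m%n≡m a<n)

  scale-scale : ∀ u v a → scale u (scale v a) ≡ scale (u * v) a
  scale-scale u v a = trans (≈-*ˡ u (%-≈ (v * a))) (cong (_% n) (sym (*-assoc u v a)))

  scale-n∸1 : 0 < a → a < n → scale (n ∸ 1) a ≡ n ∸ a
  scale-n∸1 {a} 0<a a<n = ≈⇒≡ (trans (%-≈ ((n ∸ 1) * a)) (≈-cancelʳ-+ a (begin
    ((n ∸ 1) * a + a) % n  ≡⟨ cong (_% n) ([n∸1]*a+a≡a*n a) ⟩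
    (a * n) % n            ≡⟨ *n≈0 a ⟩
    0 % n                  ≡⟨ *n≈0 1 ⟨
    (1 * n) % n            ≡⟨ cong (_% n) (trans (*-identityˡ n) (sym (m∸n+n≡m (<⇒≤ a<n)))) ⟩
    (n ∸ a + a) % n        ∎))) (scale-< (n ∸ 1) a) (∸-monoʳ-< 0<a (<⇒≤ a<n))
    where open ≡-Reasoning

  scale-inverse : (v-inv : Invertible v) → ∀ a → scale (Invertible.inverse v-inv) (scale v a) ≡ a % n
  scale-inverse {v} (invertible w vw≈1) a = begin
    scale w (scale v a)  ≡⟨ scale-scale w v a ⟩
    (w * v * a) % n      ≡⟨ ≈-* (trans (cong (_% n) (*-comm w v)) vw≈1) refl ⟩
    (1 * a) % n          ≡⟨ cong (_% n) (*-identityˡ a) ⟩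
    a % n                ∎
    where open ≡-Reasoning

  affine-surjective : Invertible a → ∀ q s → ∃ λ k → q + k * a ≈ s
  affine-surjective {a} (invertible a⁻¹ aa⁻¹≈1) q s = a⁻¹ * t , (begin
    (q + a⁻¹ * t * a) % n       ≡⟨ cong (_% n) (rearrange q a⁻¹ t a) ⟩
    (q + t * (a * a⁻¹)) % n     ≡⟨ ≈-+ {q} refl (≈-*ˡ t aa⁻¹≈1) ⟩
    (q + t * 1) % n             ≡⟨ cong (λ x → (q + x) % n) (*-identityʳ t) ⟩
    (q + (s + (n ∸ 1) * q)) % n ≡⟨ cong (_% n) (rearrange′ q s (n ∸ 1)) ⟩
    (s + ((n ∸ 1) * q + q)) % n ≡⟨ cong (λ x → (s + x) % n) ([n∸1]*a+a≡a*n q) ⟩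
    (s + q * n) % n             ≡⟨ [m+kn]%n≡m%n s q n ⟩
    s % n                       ∎)
    where
    open ≡-Reasoning
    t = s + (n ∸ 1) * q
    rearrange : ∀ q a⁻¹ t a → q + a⁻¹ * t * a ≡ q + t * (a * a⁻¹)
    rearrange = solve-∀
    rearrange′ : ∀ q s k → q + (s + k * q) ≡ s + (k * q + q)
    rearrange′ = solve-∀

  scale-+ : ∀ c a b → (scale c a + scale c b) % n ≡ scale c ((a + b) % n)
  scale-+ c a b = begin
    (scale c a + scale c b) % n  ≡⟨ ≈-+ (%-≈ (c * a)) (%-≈ (c * b)) ⟩
    (c * a + c * b) % n          ≡⟨ cong (_% n) (*-distribˡ-+ c a b) ⟨
    (c * (a + b)) % n            ≡⟨ ≈-*ˡ c (%-≈ (a + b)) ⟨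
    (c * ((a + b) % n)) % n      ∎
    where open ≡-Reasoning

  inverse-invertible : (v-inv : Invertible v) → Invertible (Invertible.inverse v-inv)
  inverse-invertible {v} (invertible w vw≈1) = invertible v (trans (cong (_% n) (*-comm w v)) vw≈1)

  *-cancelʳ-≈0 : Invertible v → a * v ≈ 0 → a ≈ 0
  *-cancelʳ-≈0 {v} {a} (invertible w vw≈1) av≈0 = begin
    a % n            ≡⟨ cong (_% n) (*-identityʳ a) ⟨
    (a * 1) % n      ≡⟨ ≈-*ˡ a vw≈1 ⟨
    (a * (v * w)) % n ≡⟨ cong (_% n) (*-assoc a v w) ⟨
    (a * v * w) % n  ≡⟨ ≈-* av≈0 refl ⟩
    0 % n            ∎
    where open ≡-Reasoning

  *-inverse-cancel : (v-inv : Invertible v) → ∀ a b → scale v a * scale (Invertible.inverse v-inv) b ≈ a * b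
  *-inverse-cancel {v} (invertible w vw≈1) a b = begin
    (scale v a * scale w b) % n  ≡⟨ ≈-* (%-≈ (v * a)) (%-≈ (w * b)) ⟩
    (v * a * (w * b)) % n        ≡⟨ cong (_% n) (rearrange v a w b) ⟩
    (a * b * (v * w)) % n        ≡⟨ ≈-*ˡ (a * b) vw≈1 ⟩
    (a * b * 1) % n              ≡⟨ cong (_% n) (*-identityʳ (a * b)) ⟩
    (a * b) % n                  ∎
    where
    open ≡-Reasoning
    rearrange : ∀ v a w b → v * a * (w * b) ≡ a * b * (v * w)
    rearrange = solve-∀

  IsNonzeroResidue : ℕ → Set
  IsNonzeroResidue a = 0 < a × a < n

  scale-nonzeroResidue : Invertible v → IsNonzeroResidue a → IsNonzeroResidue (scale v a)
  scale-nonzeroResidue {v} {a} v-inv@(invertible w _) (0<a , a<n) = positive , scale-< v a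
    where
    positive : 0 < scale v a
    positive with scale v a in eq
    ... | suc _ = s≤s z≤n
    ... | zero  = ⊥-elim (<⇒≢ 0<a (sym (begin
      a                    ≡⟨ m<n⇒m%n≡m a<n ⟨
      a % n                ≡⟨ scale-inverse v-inv a ⟨
      scale w (scale v a)  ≡⟨ cong (scale w) eq ⟩
      (w * 0) % n          ≡⟨ cong (_% n) (*-zeroʳ w) ⟩
      0 % n                ≡⟨ m*n%n≡0 0 n ⟩
      0                    ∎)))
      where open ≡-Reasoning

  ∣-scale : ∀ v → d ∣ n → d ∣ a → d ∣ scale v a
  ∣-scale v d∣n d∣a = %-presˡ-∣ (∣n⇒∣m*n v d∣a) d∣n

  ∣-scale⁻¹ : Invertible v → d ∣ n → d ∣ scale v a → d ∣ a
  ∣-scale⁻¹ {a = a} v-inv d∣n d∣va =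
    ∣n∣m%n⇒∣m d∣n (subst (_ ∣_) (scale-inverse v-inv a) (∣-scale (Invertible.inverse v-inv) d∣n d∣va))

  sumF-cong-≈ : ∀ {k} {f g : Fin k → ℕ} → (∀ i → f i ≈ g i) → sumF f ≈ sumF g
  sumF-cong-≈ {zero}  eq = refl
  sumF-cong-≈ {suc k} eq = ≈-+ (eq zero) (sumF-cong-≈ (λ i → eq (suc i)))

  sumF-scale : ∀ {k} v (f : Fin k → ℕ) → sumF (λ i → scale v (f i)) ≈ sumF f * v
  sumF-scale v f = trans (sumF-cong-≈ (λ i → trans (%-≈ (v * f i)) (cong (_% n) (*-comm v (f i)))))
                         (cong (_% n) (sumF-*ʳ f v))

  ∣-sumF-scale : ∀ {k} v (f : Fin k → ℕ) → n ∣ sumF f → n ∣ sumF (λ i → scale v (f i))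
  ∣-sumF-scale v f n∣Σf = ≈0⇒∣ (trans (sumF-scale v f) (≈-* (∣⇒≈0 n∣Σf) refl))

  NormOneMultiplier : ∀ {k} → (Fin k → ℕ) → Set
  NormOneMultiplier y = ∃ λ v → Invertible v × sumF (λ i → scale v (y i)) ≡ n

  normOneMultiplier-scale : ∀ {k} {y : Fin k → ℕ} → Invertible c →
    NormOneMultiplier (λ i → scale c (y i)) → NormOneMultiplier y
  normOneMultiplier-scale {c} {y = y} c-inv (v , v-inv , Σ≡n) =
    v * c , invertible-* v-inv c-inv , trans (sumF-cong (λ i → sym (scale-scale v c (y i)))) Σ≡n

  sumF-scale-n∸1 : ∀ {k} (y : Fin k → ℕ) → (∀ i → IsNonzeroResidue (y i)) →
    sumF (λ i → scale (n ∸ 1) (y i)) + sumF y ≡ k * n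
  sumF-scale-n∸1 {zero}  y res = refl
  sumF-scale-n∸1 {suc k} y res = begin
    (scale (n ∸ 1) (y zero) + S′) + (y zero + S)  ≡⟨ cong (λ x → (x + S′) + (y zero + S)) (scale-n∸1 0<y₀ y₀<n) ⟩
    (n ∸ y zero + S′) + (y zero + S)              ≡⟨ interchange (n ∸ y zero) S′ (y zero) S ⟩
    (n ∸ y zero + y zero) + (S′ + S)              ≡⟨ cong₂ _+_ (m∸n+n≡m (<⇒≤ y₀<n)) (sumF-scale-n∸1 (λ i → y (suc i)) (λ i → res (suc i))) ⟩
    n + k * n                                     ∎
    where
    open ≡-Reasoning
    S  = sumF (λ i → y (suc i))
    S′ = sumF (λ i → scale (n ∸ 1) (y (suc i)))
    0<y₀ = proj₁ (res zero)
    y₀<n = proj₂ (res zero)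
    interchange : ∀ a b c d → (a + b) + (c + d) ≡ (a + c) + (b + d)
    interchange = solve-∀

  normOneMultiplier-of-≢2n : (y : Fin 4 → ℕ) → (∀ i → IsNonzeroResidue (y i)) →
    n ∣ sumF y → sumF y ≢ 2 * n → NormOneMultiplier y
  normOneMultiplier-of-≢2n y res (divides j Σy≡jn) Σy≢2n = by-quotient j Σy≡jn
    where
    S′ = sumF (λ i → scale (n ∸ 1) (y i))
    flip : S′ + sumF y ≡ 4 * n
    flip = sumF-scale-n∸1 y res
    0<Σy : 0 < sumF y
    0<Σy = ≤-trans (proj₁ (res zero)) (m≤m+n _ _)
    0<S′ : 0 < S′
    0<S′ = ≤-trans (proj₁ (scale-nonzeroResidue invertible-n∸1 (res zero))) (m≤m+n _ _)
    by-quotient : ∀ j → sumF y ≡ j * n → NormOneMultiplier y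
    by-quotient 0 Σy≡0 = ⊥-elim (<⇒≢ 0<Σy (sym Σy≡0))
    by-quotient 1 Σy≡n = 1 , invertible-1 ,
      trans (sumF-cong (λ i → scale-1 (proj₂ (res i)))) (trans Σy≡n (*-identityˡ n))
    by-quotient 2 Σy≡2n = ⊥-elim (Σy≢2n Σy≡2n)
    by-quotient 3 Σy≡3n = n ∸ 1 , invertible-n∸1 ,
      +-cancelʳ-≡ (3 * n) S′ n (trans (cong (S′ +_) (sym Σy≡3n)) flip)
    by-quotient (suc (suc (suc (suc j)))) Σy≡[4+j]n = ⊥-elim (<⇒≱ 4n<S′+Σy (≤-reflexive flip))
      where
      4n<S′+Σy : 4 * n < S′ + sumF y
      4n<S′+Σy = begin-strict
        4 * n                     ≤⟨ m≤m+n (4 * n) (j * n) ⟩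
        4 * n + j * n             ≡⟨ *-distribʳ-+ n 4 j ⟨
        (4 + j) * n               ≡⟨ Σy≡[4+j]n ⟨
        sumF y                    <⟨ +-monoˡ-< (sumF y) 0<S′ ⟩
        S′ + sumF y               ∎
        where open ≤-Reasoning

Central : ℕ → ℕ → Set
Central n a = 2 * n ≤ 5 * a × 5 * a ≤ 3 * n

central⇒< : ∀ {n a} .{{_ : NonZero n}} → Central n a → a < n
central⇒< {n} {a} (_ , 5a≤3n) = *-cancelˡ-< 5 a n (≤-<-trans 5a≤3n (*-monoˡ-< n {3} {5} (s≤s (s≤s (s≤s (s≤s z≤n))))))

module CentralMultiples (n : ℕ) .{{_ : NonZero n}} (2⊥n : Coprime 2 n) (3⊥n : Coprime 3 n) where
  open Modular n

  HasCentralMultiple : ℕ → Set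
  HasCentralMultiple t = ∃ λ c → Invertible c × Central n (scale c t)

  -- Double r until 2r or 3r lands in [2n/5, 3n/5]; the fuel f runs out only if r ≥ n.
  central-product : ∀ f r → n < f + r → 0 < r → 10 * r ≤ 3 * n →
    ∃ λ c → Invertible c × Central n (c * r)
  central-product zero r n<r _ 10r≤3n =
    ⊥-elim (<⇒≱ (*-monoʳ-< 10 n<r) (≤-trans 10r≤3n (*-monoˡ-≤ n {3} {10} (s≤s (s≤s (s≤s z≤n))))))
  central-product (suc f) r n<1+f+r 0<r 10r≤3n with 2 * n ≤? 10 * r
  ... | yes 2n≤10r = 2 , coprime⇒invertible 2⊥n ,
      subst (2 * n ≤_) (10r≡5[2r] r) 2n≤10r , subst (_≤ 3 * n) (10r≡5[2r] r) 10r≤3n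
    where
    10r≡5[2r] : ∀ r → 10 * r ≡ 5 * (2 * r)
    10r≡5[2r] = solve-∀
  ... | no 2n≰10r with 2 * n ≤? 15 * r
  ... | yes 2n≤15r = 3 , coprime⇒invertible 3⊥n ,
      subst (2 * n ≤_) (15r≡5[3r] r) 2n≤15r , subst (_≤ 3 * n) (15r≡5[3r] r) 15r≤3n
    where
    15r≡5[3r] : ∀ r → 15 * r ≡ 5 * (3 * r)
    15r≡5[3r] = solve-∀
    15r≤3n : 15 * r ≤ 3 * n
    15r≤3n = <⇒≤ (*-cancelˡ-< 2 (15 * r) (3 * n) (begin-strict
      2 * (15 * r) ≡⟨ rearrange r ⟩
      3 * (10 * r) <⟨ *-monoʳ-< 3 (≰⇒> 2n≰10r) ⟩
      3 * (2 * n)  ≡⟨ swap n ⟩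
      2 * (3 * n)  ∎))
      where
      open ≤-Reasoning
      rearrange : ∀ r → 2 * (15 * r) ≡ 3 * (10 * r)
      rearrange = solve-∀
      swap : ∀ n → 3 * (2 * n) ≡ 2 * (3 * n)
      swap = solve-∀
  ... | no 2n≰15r = double (central-product f (2 * r) n<f+2r (≤-trans 0<r (m≤n*m r 2)) 20r≤3n)
    where
    n<f+2r : n < f + 2 * r
    n<f+2r = begin-strict
      n              <⟨ n<1+f+r ⟩
      suc f + r      ≤⟨ +-monoˡ-≤ (f + r) 0<r ⟩
      r + (f + r)    ≡⟨ rearrange f r ⟩
      f + 2 * r      ∎
      where
      open ≤-Reasoning
      rearrange : ∀ f r → r + (f + r) ≡ f + 2 * r
      rearrange = solve-∀
    20r≤3n : 10 * (2 * r) ≤ 3 * n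
    20r≤3n = <⇒≤ (*-cancelˡ-< 3 (10 * (2 * r)) (3 * n) (begin-strict
      3 * (10 * (2 * r)) ≡⟨ rearrange r ⟩
      4 * (15 * r)       <⟨ *-monoʳ-< 4 (≰⇒> 2n≰15r) ⟩
      4 * (2 * n)        ≡⟨ rearrange′ n ⟩
      8 * n              ≤⟨ *-monoˡ-≤ n (n≤1+n 8) ⟩
      9 * n              ≡⟨ *-assoc 3 3 n ⟩
      3 * (3 * n)        ∎))
      where
      open ≤-Reasoning
      rearrange : ∀ r → 3 * (10 * (2 * r)) ≡ 4 * (15 * r)
      rearrange = solve-∀
      rearrange′ : ∀ n → 4 * (2 * n) ≡ 8 * n
      rearrange′ = solve-∀
    double : (∃ λ c → Invertible c × Central n (c * (2 * r))) → ∃ λ c → Invertible c × Central n (c * r)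
    double (c , c-inv , central) = 2 * c , invertible-* (coprime⇒invertible 2⊥n) c-inv ,
      subst (Central n) (c*[2*r]≡2*c*r c r) central
      where
      c*[2*r]≡2*c*r : ∀ c r → c * (2 * r) ≡ 2 * c * r
      c*[2*r]≡2*c*r = solve-∀

  hasCentralMultiple-small : ∀ {r} → 0 < r → 10 * r ≤ 3 * n → HasCentralMultiple r
  hasCentralMultiple-small {r} 0<r 10r≤3n with central-product n r (m<m+n n 0<r) 0<r 10r≤3n
  ... | c , c-inv , central = c , c-inv , subst (Central n) (sym (m<n⇒m%n≡m (central⇒< central))) central

  hasCentralMultiple-scale : ∀ {d t} → Invertible d → HasCentralMultiple (scale d t) → HasCentralMultiple t
  hasCentralMultiple-scale {d} {t} d-inv (c , c-inv , central) =
    c * d , invertible-* c-inv d-inv , subst (Central n) (scale-scale c d t) central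

  hasCentralMultiple-n∸ : ∀ {t} → 0 < t → t < n → HasCentralMultiple (n ∸ t) → HasCentralMultiple t
  hasCentralMultiple-n∸ 0<t t<n h =
    hasCentralMultiple-scale invertible-n∸1 (subst HasCentralMultiple (sym (scale-n∸1 0<t t<n)) h)

  -- Below 2n/5 but above 3n/10, multiplying by 3 lands within n/5 of 0 or of n.
  hasCentralMultiple-below : ∀ {t} → 0 < t → 5 * t < 2 * n → HasCentralMultiple t
  hasCentralMultiple-below {t} 0<t 5t<2n with 10 * t ≤? 3 * n
  ... | yes 10t≤3n = hasCentralMultiple-small 0<t 10t≤3n
  ... | no 10t≰3n with n ≤? 3 * t
  ... | yes n≤3t = hasCentralMultiple-scale (coprime⇒invertible 3⊥n)
      (subst HasCentralMultiple (sym scale-3) (hasCentralMultiple-small 0<3t∸n 10[3t∸n]≤3n))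
    where
    3t∸n<n : 3 * t ∸ n < n
    3t∸n<n = begin-strict
      3 * t ∸ n    <⟨ ∸-monoˡ-< (≤-<-trans (*-monoˡ-≤ t (m≤m+n 3 2)) 5t<2n) n≤3t ⟩
      2 * n ∸ n    ≡⟨ cong (_∸ n) (cong (n +_) (+-identityʳ n)) ⟩
      n + n ∸ n    ≡⟨ m+n∸n≡m n n ⟩
      n            ∎
      where open ≤-Reasoning
    scale-3 : scale 3 t ≡ 3 * t ∸ n
    scale-3 = trans (sym (m≤n⇒[n∸m]%m≡n%m n≤3t)) (m<n⇒m%n≡m 3t∸n<n)
    0<3t∸n : 0 < 3 * t ∸ n
    0<3t∸n = m<n⇒0<n∸m (≤∧≢⇒< n≤3t n≢3t)
      where
      n≢3t : n ≢ 3 * t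
      n≢3t n≡3t with 3⊥n (∣-refl , divides t (trans n≡3t (*-comm 3 t)))
      ... | ()
    10[3t∸n]≤3n : 10 * (3 * t ∸ n) ≤ 3 * n
    10[3t∸n]≤3n = begin
      10 * (3 * t ∸ n)       ≡⟨ *-distribˡ-∸ 10 (3 * t) n ⟩
      10 * (3 * t) ∸ 10 * n  ≤⟨ ∸-monoˡ-≤ (10 * n) 30t≤12n ⟩
      12 * n ∸ 10 * n        ≡⟨ cong (_∸ 10 * n) (*-distribʳ-+ n 2 10) ⟩
      2 * n + 10 * n ∸ 10 * n ≡⟨ m+n∸n≡m (2 * n) (10 * n) ⟩
      2 * n                  ≤⟨ *-monoˡ-≤ n (m≤m+n 2 1) ⟩
      3 * n                  ∎
      where
      open ≤-Reasoning
      30t≤12n : 10 * (3 * t) ≤ 12 * n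
      30t≤12n = begin
        10 * (3 * t) ≡⟨ rearrange t ⟩
        6 * (5 * t)  ≤⟨ *-monoʳ-≤ 6 (<⇒≤ 5t<2n) ⟩
        6 * (2 * n)  ≡⟨ *-assoc 6 2 n ⟨
        12 * n       ∎
        where
        rearrange : ∀ t → 10 * (3 * t) ≡ 6 * (5 * t)
        rearrange = solve-∀
  ... | no n≰3t = hasCentralMultiple-scale (coprime⇒invertible 3⊥n)
      (subst HasCentralMultiple (sym (m<n⇒m%n≡m 3t<n))
        (hasCentralMultiple-n∸ 0<3t 3t<n (hasCentralMultiple-small (m<n⇒0<n∸m 3t<n) 10[n∸3t]≤3n)))
    where
    3t<n : 3 * t < n
    3t<n = ≰⇒> n≰3t
    0<3t : 0 < 3 * t
    0<3t = ≤-trans 0<t (m≤n*m t 3)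
    10[n∸3t]≤3n : 10 * (n ∸ 3 * t) ≤ 3 * n
    10[n∸3t]≤3n = begin
      10 * (n ∸ 3 * t)       ≡⟨ *-distribˡ-∸ 10 n (3 * t) ⟩
      10 * n ∸ 10 * (3 * t)  ≤⟨ ∸-monoʳ-≤ (10 * n) 9n≤30t ⟩
      10 * n ∸ 9 * n         ≡⟨ cong (_∸ 9 * n) (*-distribʳ-+ n 1 9) ⟩
      1 * n + 9 * n ∸ 9 * n  ≡⟨ m+n∸n≡m (1 * n) (9 * n) ⟩
      1 * n                  ≤⟨ *-monoˡ-≤ n (m≤m+n 1 2) ⟩
      3 * n                  ∎
      where
      open ≤-Reasoning
      9n≤30t : 9 * n ≤ 10 * (3 * t)
      9n≤30t = begin
        9 * n        ≡⟨ *-assoc 3 3 n ⟩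
        3 * (3 * n)  ≤⟨ *-monoʳ-≤ 3 (<⇒≤ (≰⇒> 10t≰3n)) ⟩
        3 * (10 * t) ≡⟨ rearrange t ⟩
        10 * (3 * t) ∎
        where
        rearrange : ∀ t → 3 * (10 * t) ≡ 10 * (3 * t)
        rearrange = solve-∀

  hasCentralMultiple : ∀ {t} → 0 < t → t < n → HasCentralMultiple t
  hasCentralMultiple {t} 0<t t<n with 5 * t <? 2 * n
  ... | yes 5t<2n = hasCentralMultiple-below 0<t 5t<2n
  ... | no 5t≮2n with 5 * t ≤? 3 * n
  ... | yes 5t≤3n = 1 , invertible-1 , subst (Central n) (sym (scale-1 t<n)) (≮⇒≥ 5t≮2n , 5t≤3n)
  ... | no 5t≰3n = hasCentralMultiple-n∸ 0<t t<n (hasCentralMultiple-below (m<n⇒0<n∸m t<n) 5[n∸t]<2n)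
    where
    5[n∸t]<2n : 5 * (n ∸ t) < 2 * n
    5[n∸t]<2n = begin-strict
      5 * (n ∸ t)       ≡⟨ *-distribˡ-∸ 5 n t ⟩
      5 * n ∸ 5 * t     <⟨ ∸-monoʳ-< (≰⇒> 5t≰3n) (*-monoʳ-≤ 5 (<⇒≤ t<n)) ⟩
      5 * n ∸ 3 * n     ≡⟨ cong (_∸ 3 * n) (*-distribʳ-+ n 2 3) ⟩
      2 * n + 3 * n ∸ 3 * n ≡⟨ m+n∸n≡m (2 * n) (3 * n) ⟩
      2 * n             ∎
      where open ≤-Reasoning

[x*m+r]%n≡[x%p]*m+r : ∀ {n p m} .{{_ : NonZero n}} .{{_ : NonZero p}} → p * m ≡ n →
  ∀ x {r} → r < m → (x * m + r) % n ≡ x % p * m + r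
[x*m+r]%n≡[x%p]*m+r {p = p} {m} refl x r<m =
  trans ([m*n+o]%[p*n]≡[m*n]%[p*n]+o x p r<m) (cong (_+ _) (sym (m%n*o≡m*o%[n*o] x p m)))

prime∤⇒coprime : ∀ {p a} → Prime p → ¬ p ∣ a → Coprime a p
prime∤⇒coprime p-prime p∤a (d∣a , d∣p) with prime⇒irreducible p-prime d∣p
... | inj₁ d≡1 = d≡1
... | inj₂ refl = ⊥-elim (p∤a d∣a)

between-s-and-1+s : ∀ {s s′} → s′ ≡ s ⊎ s′ ≡ suc s → s ≤ s′ × s′ ≤ suc s
between-s-and-1+s (inj₁ refl) = ≤-refl , n≤1+n _
between-s-and-1+s (inj₂ refl) = n≤1+n _ , ≤-refl

-- With n = p m, the multiplier 1 + k m fixes the multiples of p and sends a = q m + r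
-- (r < m) to ((q + k a) mod p) m + r.  When p ∤ a every digit q + k a is reachable, and of
-- two consecutive target digits one keeps 1 + k m invertible.
module UnitsCongruentToOne (n p m : ℕ) .{{_ : NonZero n}} .{{_ : NonZero p}} .{{_ : NonZero m}}
  (p-prime : Prime p) (pm≡n : p * m ≡ n) where
  open Modular n

  p∣n : p ∣ n
  p∣n = divides m (trans (sym pm≡n) (*-comm p m))

  scale-1+k*m-fixes : ∀ k {a} → p ∣ a → a < n → scale (1 + k * m) a ≡ a
  scale-1+k*m-fixes k {a} (divides c refl) a<n = begin
    ((1 + k * m) * (c * p)) % n          ≡⟨ cong (_% n) (expand k m c p) ⟩
    (c * p + (k * c) * (p * m)) % n      ≡⟨ cong (λ x → (c * p + (k * c) * x) % n) pm≡n ⟩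
    (c * p + (k * c) * n) % n            ≡⟨ [m+kn]%n≡m%n (c * p) (k * c) n ⟩
    (c * p) % n                          ≡⟨ m<n⇒m%n≡m a<n ⟩
    c * p                                ∎
    where
    open ≡-Reasoning
    expand : ∀ k m c p → (1 + k * m) * (c * p) ≡ c * p + (k * c) * (p * m)
    expand = solve-∀

  scale-1+k*m : ∀ k a → scale (1 + k * m) a ≡ (a / m + k * a) % p * m + a % m
  scale-1+k*m k a = begin
    ((1 + k * m) * a) % n                  ≡⟨ cong (λ x → ((1 + k * m) * x) % n) a≡ ⟩
    ((1 + k * m) * (a % m + a / m * m)) % n ≡⟨ cong (_% n) (expand k m (a % m) (a / m)) ⟩
    ((a / m + k * (a % m + a / m * m)) * m + a % m) % n ≡⟨ cong (λ x → ((a / m + k * x) * m + a % m) % n) (sym a≡) ⟩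
    ((a / m + k * a) * m + a % m) % n     ≡⟨ [x*m+r]%n≡[x%p]*m+r pm≡n (a / m + k * a) (m%n<n a m) ⟩
    (a / m + k * a) % p * m + a % m       ∎
    where
    open ≡-Reasoning
    a≡ : a ≡ a % m + a / m * m
    a≡ = m≡m%n+[m/n]*n a m
    expand : ∀ k m r q → (1 + k * m) * (r + q * m) ≡ (q + k * (r + q * m)) * m + r
    expand = solve-∀

  invertible-1+k*m : ∀ k a → ¬ p ∣ scale (1 + k * m) a → Invertible (1 + k * m)
  invertible-1+k*m k a p∤ua = coprime⇒invertible (subst (Coprime unit) pm≡n (Coprimality.sym
    (coprime-*ˡ (Coprimality.sym u⊥p) (Coprimality.sym u⊥m))))
    where
    unit = 1 + k * m
    u⊥m : Coprime unit m
    u⊥m {d} (d∣u , d∣m) = ∣1⇒≡1 (∣m+n∣m⇒∣n (subst (d ∣_) (+-comm 1 (k * m)) d∣u) (∣n⇒∣m*n k d∣m))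
    u⊥p : Coprime unit p
    u⊥p (d∣u , d∣p) with prime⇒irreducible p-prime d∣p
    ... | inj₁ d≡1 = d≡1
    ... | inj₂ refl = ⊥-elim (p∤ua (%-presˡ-∣ (∣m⇒∣m*n a d∣u) p∣n))

  digit-avoiding-p : ∀ {a} → ¬ p ∣ a → ∀ s → ∃ λ s′ → (s′ ≡ s ⊎ s′ ≡ suc s) × ¬ p ∣ s′ * m + a % m
  digit-avoiding-p {a} p∤a s with p ∣? (s * m + a % m)
  ... | no p∤ = s , inj₁ refl , p∤
  ... | yes p∣ = suc s , inj₂ refl , λ p∣′ → p∤a (p∣a p∣′)
    where
    p∣a : p ∣ suc s * m + a % m → p ∣ a
    p∣a p∣′ = subst (p ∣_) (sym (m≡m%n+[m/n]*n a m)) (∣m∣n⇒∣m+n p∣r (∣n⇒∣m*n (a / m) p∣m))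
      where
      p∣m : p ∣ m
      p∣m = ∣m+n∣m⇒∣n (subst (p ∣_) (rearrange m (s * m) (a % m)) p∣′) p∣
        where
        rearrange : ∀ m x r → m + x + r ≡ x + r + m
        rearrange = solve-∀
      p∣r : p ∣ a % m
      p∣r = ∣m+n∣m⇒∣n p∣ (∣n⇒∣m*n s p∣m)

  window-multiplier : ∀ {a} → ¬ p ∣ a → ∀ s → suc s < p → ∃ λ k → Invertible (1 + k * m) ×
    s * m ≤ scale (1 + k * m) a × scale (1 + k * m) a < (2 + s) * m
  window-multiplier {a} p∤a s 1+s<p with digit-avoiding-p p∤a s
  ... | s′ , s′≡s⊎s′≡1+s , p∤s′m+r
    with Modular.affine-surjective p (Modular.coprime⇒invertible p (prime∤⇒coprime p-prime p∤a)) (a / m) s′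
  ... | k , digit≈s′ = k , invertible-1+k*m k a (subst (¬_ ∘ (p ∣_)) (sym scale≡) p∤s′m+r) ,
        subst (s * m ≤_) (sym scale≡) (≤-trans (*-monoˡ-≤ m s≤s′) (m≤m+n (s′ * m) r)) ,
        subst (_< (2 + s) * m) (sym scale≡) (<-≤-trans (+-monoʳ-< (s′ * m) (m%n<n a m))
          (subst (_≤ (2 + s) * m) (+-comm m (s′ * m)) (*-monoˡ-≤ m (s≤s s′≤1+s))))
    where
    r = a % m
    s≤s′ : s ≤ s′
    s≤s′ = proj₁ (between-s-and-1+s s′≡s⊎s′≡1+s)
    s′≤1+s : s′ ≤ suc s
    s′≤1+s = proj₂ (between-s-and-1+s s′≡s⊎s′≡1+s)
    s′<p : s′ < p
    s′<p = ≤-<-trans s′≤1+s 1+s<p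
    scale≡ : scale (1 + k * m) a ≡ s′ * m + r
    scale≡ = trans (scale-1+k*m k a) (cong (λ x → x * m + r) (trans digit≈s′ (m<n⇒m%n≡m s′<p)))

<2n⇒≡%+n⊎≡% : ∀ {n a} .{{_ : NonZero n}} → a < 2 * n → a ≡ a % n + n ⊎ a ≡ a % n
<2n⇒≡%+n⊎≡% {n} {a} a<2n with a / n | m≡m%n+[m/n]*n a n | m<n*o⇒m/o<n {a} {2} {n} a<2n
... | 0 | a≡r+0 | _ = inj₂ (trans a≡r+0 (+-identityʳ (a % n)))
... | 1 | a≡r+n | _ = inj₁ (trans a≡r+n (cong (a % n +_) (+-identityʳ n)))
... | suc (suc _) | _ | s≤s (s≤s ())

complement-of-central-≤ : ∀ {F Y m n} → F + Y ≡ n → 2 * n ≤ 5 * F → 5 * m ≤ n → Y + 2 * m ≤ n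
complement-of-central-≤ {F} {Y} {m} {n} F+Y≡n 2n≤5F 5m≤n = *-cancelˡ-≤ 5 (begin
  5 * (Y + 2 * m)      ≡⟨ expand Y m ⟩
  5 * Y + 2 * (5 * m)  ≤⟨ +-monoʳ-≤ (5 * Y) (*-monoʳ-≤ 2 5m≤n) ⟩
  5 * Y + 2 * n        ≤⟨ +-monoʳ-≤ (5 * Y) 2n≤5F ⟩
  5 * Y + 5 * F        ≡⟨ *-distribˡ-+ 5 Y F ⟨
  5 * (Y + F)          ≡⟨ cong (5 *_) (trans (+-comm Y F) F+Y≡n) ⟩
  5 * n                ∎)
  where
  open ≤-Reasoning
  expand : ∀ Y m → 5 * (Y + 2 * m) ≡ 5 * Y + 2 * (5 * m)
  expand = solve-∀

complement-of-central-≥ : ∀ {F Y m n} → F + Y ≡ 2 * n → 5 * F ≤ 3 * n → 5 * m ≤ n → n + 2 * m ≤ Y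
complement-of-central-≥ {F} {Y} {m} {n} F+Y≡2n 5F≤3n 5m≤n = *-cancelˡ-≤ 5 (+-cancelʳ-≤ (5 * F) _ _ (begin
  5 * (n + 2 * m) + 5 * F       ≡⟨ expand n m F ⟩
  5 * n + 2 * (5 * m) + 5 * F   ≤⟨ +-mono-≤ (+-monoʳ-≤ (5 * n) (*-monoʳ-≤ 2 5m≤n)) 5F≤3n ⟩
  5 * n + 2 * n + 3 * n         ≡⟨ collect n ⟩
  5 * (2 * n)                   ≡⟨ cong (5 *_) F+Y≡2n ⟨
  5 * (F + Y)                   ≡⟨ expand′ F Y ⟩
  5 * Y + 5 * F                 ∎))
  where
  open ≤-Reasoning
  expand : ∀ n m F → 5 * (n + 2 * m) + 5 * F ≡ 5 * n + 2 * (5 * m) + 5 * F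
  expand = solve-∀
  collect : ∀ n → 5 * n + 2 * n + 3 * n ≡ 5 * (2 * n)
  collect = solve-∀
  expand′ : ∀ F Y → 5 * (F + Y) ≡ 5 * Y + 5 * F
  expand′ = solve-∀

module LeavingTwoN (n p m : ℕ) .{{_ : NonZero n}} .{{_ : NonZero p}} .{{_ : NonZero m}}
  (p-prime : Prime p) (pm≡n : p * m ≡ n) (5≤p : 5 ≤ p) where
  open Modular n
  open UnitsCongruentToOne n p m p-prime pm≡n

  5m≤n : 5 * m ≤ n
  5m≤n = subst (5 * m ≤_) pm≡n (*-monoˡ-≤ m 5≤p)

  2≤p : 2 ≤ p
  2≤p = ≤-trans (m≤m+n 2 3) 5≤p

  1+[p∸2]<p : suc (p ∸ 2) < p
  1+[p∸2]<p = <-≤-trans (n<1+n (suc (p ∸ 2))) (≤-reflexive (m+[n∸m]≡n 2≤p))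

  z₀+z₁<2n : (z : Fin 4 → ℕ) → (∀ i → IsNonzeroResidue (z i)) → z (# 0) + z (# 1) < 2 * n
  z₀+z₁<2n z res = subst (z (# 0) + z (# 1) <_) (cong (n +_) (sym (+-identityʳ n)))
    (+-mono-< (proj₂ (res (# 0))) (proj₂ (res (# 1))))

  scale-last-two : ∀ k (z : Fin 4 → ℕ) → (∀ i → IsNonzeroResidue (z i)) → p ∣ z (# 0) → p ∣ z (# 1) →
    sumF (λ i → scale (1 + k * m) (z i)) ≡ sumF z →
    scale (1 + k * m) (z (# 2)) + scale (1 + k * m) (z (# 3)) ≡ z (# 2) + z (# 3)
  scale-last-two k z res p∣z₀ p∣z₁ Σ′≡Σ = begin
    z₂′ + z₃′        ≡⟨ cong (z₂′ +_) (+-identityʳ z₃′) ⟨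
    z₂′ + (z₃′ + 0)  ≡⟨ +-cancelˡ-≡ (z (# 1)) _ _ (+-cancelˡ-≡ (z (# 0)) _ _ (begin
      z (# 0) + (z (# 1) + (z₂′ + (z₃′ + 0)))
        ≡⟨ cong₂ (λ a b → a + (b + (z₂′ + (z₃′ + 0))))
                 (sym (scale-1+k*m-fixes k p∣z₀ (proj₂ (res (# 0)))))
                 (sym (scale-1+k*m-fixes k p∣z₁ (proj₂ (res (# 1))))) ⟩
      sumF (λ i → scale (1 + k * m) (z i)) ≡⟨ Σ′≡Σ ⟩
      sumF z ∎)) ⟩
    z (# 2) + (z (# 3) + 0) ≡⟨ cong (z (# 2) +_) (+-identityʳ (z (# 3))) ⟩
    z (# 2) + z (# 3) ∎
    where
    open ≡-Reasoning
    z₂′ = scale (1 + k * m) (z (# 2))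
    z₃′ = scale (1 + k * m) (z (# 3))

  leave-2n-above : ∀ {F} (z : Fin 4 → ℕ) → (∀ i → IsNonzeroResidue (z i)) → sumF z ≡ 2 * n →
    p ∣ z (# 0) → p ∣ z (# 1) → ¬ p ∣ z (# 2) → 2 * n ≤ 5 * F → z (# 0) + z (# 1) ≡ F + n →
    ∃ λ u → Invertible u × sumF (λ i → scale u (z i)) ≢ 2 * n
  leave-2n-above {F} z res Σz≡2n p∣z₀ p∣z₁ p∤z₂ 2n≤5F z₀+z₁≡F+n =
    1 + k * m , u-inv , λ Σ′≡2n → <⇒≱ (z₂′+2m<n Σ′≡2n) n≤z₂′+2m
    where
    W = window-multiplier p∤z₂ (p ∸ 2) 1+[p∸2]<p
    k = proj₁ W
    u-inv = proj₁ (proj₂ W)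
    z₂′ = scale (1 + k * m) (z (# 2))
    z₃′ = scale (1 + k * m) (z (# 3))
    Y = z (# 2) + z (# 3)
    n≤z₂′+2m : n ≤ z₂′ + 2 * m
    n≤z₂′+2m = begin
      n                       ≡⟨ pm≡n ⟨
      p * m                   ≡⟨ cong (_* m) (m∸n+n≡m 2≤p) ⟨
      (p ∸ 2 + 2) * m         ≡⟨ *-distribʳ-+ m (p ∸ 2) 2 ⟩
      (p ∸ 2) * m + 2 * m     ≤⟨ +-monoˡ-≤ (2 * m) (proj₁ (proj₂ (proj₂ W))) ⟩
      z₂′ + 2 * m             ∎
      where open ≤-Reasoning
    F+Y≡n : F + Y ≡ n
    F+Y≡n = +-cancelʳ-≡ n (F + Y) n (begin
      F + Y + n                     ≡⟨ rearrange F Y n ⟩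
      (F + n) + Y                   ≡⟨ cong (_+ Y) z₀+z₁≡F+n ⟨
      (z (# 0) + z (# 1)) + Y       ≡⟨ sumF-pairs z ⟨
      sumF z                        ≡⟨ Σz≡2n ⟩
      2 * n                         ≡⟨ cong (n +_) (+-identityʳ n) ⟩
      n + n                         ∎)
      where
      open ≡-Reasoning
      rearrange : ∀ F Y n → F + Y + n ≡ (F + n) + Y
      rearrange = solve-∀
    z₂′+2m<n : sumF (λ i → scale (1 + k * m) (z i)) ≡ 2 * n → z₂′ + 2 * m < n
    z₂′+2m<n Σ′≡2n = begin-strict
      z₂′ + 2 * m        <⟨ +-monoˡ-< (2 * m) (m<m+n z₂′ (proj₁ (scale-nonzeroResidue u-inv (res (# 3))))) ⟩
      z₂′ + z₃′ + 2 * m  ≡⟨ cong (_+ 2 * m) (scale-last-two k z res p∣z₀ p∣z₁ (trans Σ′≡2n (sym Σz≡2n))) ⟩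
      Y + 2 * m          ≤⟨ complement-of-central-≤ {F} {Y} {m} F+Y≡n 2n≤5F 5m≤n ⟩
      n                  ∎
      where open ≤-Reasoning

  leave-2n-below : ∀ {F} (z : Fin 4 → ℕ) → (∀ i → IsNonzeroResidue (z i)) → sumF z ≡ 2 * n →
    p ∣ z (# 0) → p ∣ z (# 1) → ¬ p ∣ z (# 2) → 5 * F ≤ 3 * n → z (# 0) + z (# 1) ≡ F →
    ∃ λ u → Invertible u × sumF (λ i → scale u (z i)) ≢ 2 * n
  leave-2n-below {F} z res Σz≡2n p∣z₀ p∣z₁ p∤z₂ 5F≤3n z₀+z₁≡F =
    1 + k * m , proj₁ (proj₂ W) , λ Σ′≡2n → <⇒≱ z₂′+z₃′<n+2m (n+2m≤z₂′+z₃′ Σ′≡2n)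
    where
    W = window-multiplier p∤z₂ 0 2≤p
    k = proj₁ W
    z₂′ = scale (1 + k * m) (z (# 2))
    z₃′ = scale (1 + k * m) (z (# 3))
    z₂′+z₃′<n+2m : z₂′ + z₃′ < n + 2 * m
    z₂′+z₃′<n+2m = subst (z₂′ + z₃′ <_) (+-comm (2 * m) n) (+-mono-< (proj₂ (proj₂ (proj₂ W))) (scale-< (1 + k * m) (z (# 3))))
    F+Y≡2n : F + (z (# 2) + z (# 3)) ≡ 2 * n
    F+Y≡2n = trans (cong (_+ (z (# 2) + z (# 3))) (sym z₀+z₁≡F)) (trans (sym (sumF-pairs z)) Σz≡2n)
    n+2m≤z₂′+z₃′ : sumF (λ i → scale (1 + k * m) (z i)) ≡ 2 * n → n + 2 * m ≤ z₂′ + z₃′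
    n+2m≤z₂′+z₃′ Σ′≡2n = subst (n + 2 * m ≤_) (sym (scale-last-two k z res p∣z₀ p∣z₁ (trans Σ′≡2n (sym Σz≡2n))))
      (complement-of-central-≥ {F} {z (# 2) + z (# 3)} {m} F+Y≡2n 5F≤3n 5m≤n)

  leave-2n : (z : Fin 4 → ℕ) → (∀ i → IsNonzeroResidue (z i)) → sumF z ≡ 2 * n →
    p ∣ z (# 0) → p ∣ z (# 1) → ¬ p ∣ z (# 2) → Central n ((z (# 0) + z (# 1)) % n) →
    ∃ λ u → Invertible u × sumF (λ i → scale u (z i)) ≢ 2 * n
  leave-2n z res Σz≡2n p∣z₀ p∣z₁ p∤z₂ (2n≤5F , 5F≤3n) =
    [ leave-2n-above z res Σz≡2n p∣z₀ p∣z₁ p∤z₂ 2n≤5F , leave-2n-below z res Σz≡2n p∣z₀ p∣z₁ p∤z₂ 5F≤3n ]′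
      (<2n⇒≡%+n⊎≡% (z₀+z₁<2n z res))

  normOneMultiplier-of-central : (z : Fin 4 → ℕ) → (∀ i → IsNonzeroResidue (z i)) → n ∣ sumF z →
    p ∣ z (# 0) → p ∣ z (# 1) → ¬ p ∣ z (# 2) → Central n ((z (# 0) + z (# 1)) % n) →
    NormOneMultiplier z
  normOneMultiplier-of-central z res n∣Σz p∣z₀ p∣z₁ p∤z₂ central = by-cases (sumF z ≟ 2 * n)
    where
    by-cases : Dec (sumF z ≡ 2 * n) → NormOneMultiplier z
    by-cases (no Σz≢2n)  = normOneMultiplier-of-≢2n z res n∣Σz Σz≢2n
    by-cases (yes Σz≡2n) =
      let u , u-inv , Σ′≢2n = leave-2n z res Σz≡2n p∣z₀ p∣z₁ p∤z₂ central
      in normOneMultiplier-scale {y = z} u-inv (normOneMultiplier-of-≢2n (λ i → scale u (z i))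
           (λ i → scale-nonzeroResidue u-inv (res i)) (∣-sumF-scale u z n∣Σz) Σ′≢2n)

divisor-of-coprime-to-6-≥5 : ∀ {n} d → Coprime n 6 → 1 < d → d ∣ n → 5 ≤ d
divisor-of-coprime-to-6-≥5 1 _ (s≤s ()) _
divisor-of-coprime-to-6-≥5 2 n⊥6 _ 2∣n with n⊥6 (2∣n , divides 3 refl)
... | ()
divisor-of-coprime-to-6-≥5 3 n⊥6 _ 3∣n with n⊥6 (3∣n , divides 2 refl)
... | ()
divisor-of-coprime-to-6-≥5 4 n⊥6 _ 4∣n with n⊥6 (∣-trans (divides {2} 2 refl) 4∣n , divides 3 refl)
... | ()
divisor-of-coprime-to-6-≥5 (suc (suc (suc (suc (suc d))))) _ _ _ = s≤s (s≤s (s≤s (s≤s (s≤s z≤n))))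

divisor-of-6-coprime : ∀ {n k} → Coprime n 6 → k ∣ 6 → Coprime k n
divisor-of-6-coprime n⊥6 k∣6 (d∣k , d∣n) = n⊥6 (d∣n , ∣-trans d∣k k∣6)

normOneMultiplier : ∀ n .{{_ : NonZero n}} → Coprime n 6 → ∀ {p} → Prime p → p ∣ n →
  (y : Fin 4 → ℕ) → (∀ i → Modular.IsNonzeroResidue n (y i)) → n ∣ sumF y →
  ¬ n ∣ y (# 0) + y (# 1) → p ∣ y (# 0) → p ∣ y (# 1) → ¬ p ∣ y (# 2) →
  Modular.NormOneMultiplier n y
normOneMultiplier n n⊥6 {p} p-prime p∣n y res n∣Σy n∤y₀+y₁ p∣y₀ p∣y₁ p∤y₂ =
  normOneMultiplier-scale {y = y} c-inv (LeavingTwoN.normOneMultiplier-of-central n p n/p p-prime pn/p≡n 5≤p z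
    (λ i → scale-nonzeroResidue c-inv (res i)) (∣-sumF-scale c y n∣Σy)
    (∣-scale c p∣n p∣y₀) (∣-scale c p∣n p∣y₁) (p∤y₂ ∘ ∣-scale⁻¹ c-inv p∣n)
    (subst (Central n) (sym (scale-+ c (y (# 0)) (y (# 1)))) central))
  where
  open Modular n
  instance
    p≢0 : NonZero p
    p≢0 = prime⇒nonZero p-prime
  n/p = quotient p∣n
  pn/p≡n : p * n/p ≡ n
  pn/p≡n = trans (*-comm p n/p) (sym (m∣n⇒n≡quotient*m p∣n))
  instance
    n/p≢0 : NonZero n/p
    n/p≢0 = m*n≢0⇒n≢0 p {{subst NonZero (sym pn/p≡n) it}}
  5≤p : 5 ≤ p
  5≤p = divisor-of-coprime-to-6-≥5 p n⊥6 (nonTrivial⇒n>1 p {{prime⇒nonTrivial p-prime}}) p∣n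
  t = (y (# 0) + y (# 1)) % n
  0<t : 0 < t
  0<t = n≢0⇒n>0 (n∤y₀+y₁ ∘ m%n≡0⇒n∣m _ n)
  c-central = CentralMultiples.hasCentralMultiple n (divisor-of-6-coprime n⊥6 (divides 3 refl))
    (divisor-of-6-coprime n⊥6 (divides 2 refl)) 0<t (m%n<n _ n)
  c = proj₁ c-central
  c-inv = proj₁ (proj₂ c-central)
  central = proj₂ (proj₂ c-central)
  z : Fin 4 → ℕ
  z i = scale c (y i)

module Generators (n : ℕ) .{{_ : NonZero n}} where
  open Modular n

  generator⇒invertible : ∀ {h} → IsGenerator n h → Invertible h
  generator⇒invertible {h} (_ , generates) with generates (1 % n) (m%n<n 1 n)
  ... | a , ah≡1 = invertible a (trans (cong (_% n) (*-comm h a)) ah≡1)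

  generator-scale : ∀ {g w} → IsGenerator n g → Invertible w → IsGenerator n (scale w g)
  generator-scale {g} {w} (_ , generates) w-inv = scale-< w g , λ y y<n →
    let a , ag≡y = generates y y<n
        w⁻¹-inv = inverse-invertible w-inv
    in scale (Invertible.inverse w-inv) a ,
       trans (*-inverse-cancel w⁻¹-inv a g) ag≡y

  zeroSum-cancel : ∀ {k g} (x : Fin k → ℕ) → IsGenerator n g → ZeroSum n (λ i → x i * g) → n ∣ sumF x
  zeroSum-cancel x g-gen n∣Σxg =
    ≈0⇒∣ (*-cancelʳ-≈0 (generator⇒invertible g-gen) (trans (cong (_% n) (sym (sumF-*ʳ x _))) (∣⇒≈0 n∣Σxg)))

  n≤normNumerator : ∀ {k h N} {s : Fin (suc k) → ℕ} → IsGenerator n h → ZeroSum n s →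
    HasNormNumerator n h s N → n ≤ N
  n≤normNumerator {h = h} {s = s} h-gen n∣Σs (coef , isCoeff , Σcoef≡N) =
    subst (n ≤_) Σcoef≡N (∣⇒≤ {{>-nonZero 0<Σcoef}} (≈0⇒∣ (*-cancelʳ-≈0 (generator⇒invertible h-gen) Σcoef*h≈0)))
    where
    0<Σcoef : 0 < sumF coef
    0<Σcoef = ≤-trans (proj₁ (isCoeff zero)) (m≤m+n _ _)
    Σcoef*h≈0 : sumF coef * h ≈ 0
    Σcoef*h≈0 = begin
      (sumF coef * h) % n                ≡⟨ cong (_% n) (sumF-*ʳ coef h) ⟨
      sumF (λ i → coef i * h) % n        ≡⟨ sumF-cong-≈ (λ i → proj₂ (proj₂ (isCoeff i))) ⟩
      sumF s % n                         ≡⟨ ∣⇒≈0 n∣Σs ⟩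
      0 % n                              ∎
      where open ≡-Reasoning

  indexOne-of-normOneMultiplier : ∀ {k g} (x : Fin (suc k) → ℕ) → IsGenerator n g →
    ZeroSum n (λ i → x i * g) → (∀ i → IsNonzeroResidue (x i)) → NormOneMultiplier x →
    IndexOne n (λ i → x i * g)
  indexOne-of-normOneMultiplier {g = g} x g-gen zeroSum res (v , v-inv@(invertible w _) , Σ≡n) =
    (scale w g , generator-scale g-gen (inverse-invertible v-inv) ,
      (λ i → scale v (x i)) ,
      (λ i → proj₁ (scale-nonzeroResidue v-inv (res i)) , <⇒≤ (scale-< v (x i)) , *-inverse-cancel v-inv (x i) g) ,
      Σ≡n) ,
    λ h N h-gen → n≤normNumerator h-gen zeroSum

prime-divisor : ∀ {d} → 1 < d → ∃ λ p → Prime p × p ∣ d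
prime-divisor {d@(suc _)} 1<d with factorise d
... | record { factors = [] ; isFactorisation = d≡1 } = ⊥-elim (<⇒≢ 1<d (sym d≡1))
... | record { factors = p ∷ ps ; isFactorisation = d≡p*Πps ; factorsPrime = p-prime ∷ _ } =
  p , p-prime , divides (product ps) (trans d≡p*Πps (*-comm p (product ps)))

first-two : Fin 4 → Bool
first-two zero       = true
first-two (suc zero) = true
first-two _          = false

minimalZeroSum⇒¬∣x₀+x₁ : ∀ {n g} (x : Fin 4 → ℕ) → MinimalZeroSum n (λ i → x i * g) →
  ¬ n ∣ x (# 0) + x (# 1)
minimalZeroSum⇒¬∣x₀+x₁ {n} {g} x (_ , minimal) n∣x₀+x₁ = minimal first-two (zero , refl) (# 2 , refl)
  (subst (n ∣_) (expand (x (# 0)) (x (# 1)) g) (∣m⇒∣m*n g n∣x₀+x₁))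
  where
  expand : ∀ a b g → (a + b) * g ≡ a * g + (b * g + (0 + (0 + 0)))
  expand = solve-∀

prime-dividing-x₀-x₁ : ∀ {n} (x : Fin 4 → ℕ) →
  gcd n (gcd (x (# 0)) (gcd (x (# 1)) (gcd (x (# 2)) (x (# 3))))) ≡ 1 → n ∣ sumF x →
  gcd (gcd n (x (# 0))) (gcd n (x (# 1))) > 1 →
  ∃ λ p → Prime p × p ∣ n × p ∣ x (# 0) × p ∣ x (# 1) × ¬ p ∣ x (# 2)
prime-dividing-x₀-x₁ {n} x gcd≡1 n∣Σx 1<d = p , p-prime , p∣n , p∣x₀ , p∣x₁ , p∤x₂
  where
  p = proj₁ (prime-divisor 1<d)
  p-prime = proj₁ (proj₂ (prime-divisor 1<d))
  p∣d : p ∣ gcd (gcd n (x (# 0))) (gcd n (x (# 1)))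
  p∣d = proj₂ (proj₂ (prime-divisor 1<d))
  p∣n : p ∣ n
  p∣n = ∣-trans p∣d (∣-trans (gcd[m,n]∣m (gcd n (x (# 0))) (gcd n (x (# 1)))) (gcd[m,n]∣m n (x (# 0))))
  p∣x₀ : p ∣ x (# 0)
  p∣x₀ = ∣-trans p∣d (∣-trans (gcd[m,n]∣m (gcd n (x (# 0))) (gcd n (x (# 1)))) (gcd[m,n]∣n n (x (# 0))))
  p∣x₁ : p ∣ x (# 1)
  p∣x₁ = ∣-trans p∣d (∣-trans (gcd[m,n]∣n (gcd n (x (# 0))) (gcd n (x (# 1)))) (gcd[m,n]∣n n (x (# 1))))
  p∤x₂ : ¬ p ∣ x (# 2)
  p∤x₂ p∣x₂ = nonTrivial⇒≢1 {{prime⇒nonTrivial p-prime}} (∣1⇒≡1 (subst (p ∣_) gcd≡1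
    (gcd-greatest p∣n (gcd-greatest p∣x₀ (gcd-greatest p∣x₁ (gcd-greatest p∣x₂ p∣x₃))))))
    where
    p∣x₃ : p ∣ x (# 3)
    p∣x₃ = subst (p ∣_) (+-identityʳ _)
      (∣m+n∣m⇒∣n (∣m+n∣m⇒∣n (∣m+n∣m⇒∣n (∣-trans p∣n n∣Σx) p∣x₀) p∣x₁) p∣x₂)

lemma2p7 : (n : ℕ) .{{_ : NonZero n}} → Coprime n 6 →
    (∃ λ p → ∃ λ q → ∃ λ r → Prime p × Prime q × Prime r ×
       p ≢ q × p ≢ r × q ≢ r × p ∣ n × q ∣ n × r ∣ n) →
    (g : ℕ) → IsGenerator n g →
    (x : Fin 4 → ℕ) → (∀ i → 1 ≤ x i × x i ≤ n ∸ 1) →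
    gcd n (gcd (x (# 0)) (gcd (x (# 1)) (gcd (x (# 2)) (x (# 3))))) ≡ 1 →
    MinimalZeroSum n (λ i → x i * g) →
    gcd (gcd n (x (# 0))) (gcd n (x (# 1))) > 1 →
    IndexOne n (λ i → x i * g)
lemma2p7 n n⊥6 _ g g-gen x bounds gcd≡1 minimalZeroSum@(zeroSum , _) 1<d =
  let p , p-prime , p∣n , p∣x₀ , p∣x₁ , p∤x₂ = prime-dividing-x₀-x₁ x gcd≡1 n∣Σx 1<d
  in indexOne-of-normOneMultiplier x g-gen zeroSum residues
       (normOneMultiplier n n⊥6 p-prime p∣n x residues n∣Σx (minimalZeroSum⇒¬∣x₀+x₁ x minimalZeroSum)
         p∣x₀ p∣x₁ p∤x₂)
  where
  open Modular n
  open Generators n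
  residues : ∀ i → IsNonzeroResidue (x i)
  residues i = proj₁ (bounds i) , ≤-<-trans (proj₂ (bounds i)) (∸-monoʳ-< z<s (>-nonZero⁻¹ n))
  n∣Σx : n ∣ sumF x
  n∣Σx = zeroSum-cancel x g-gen zeroSum
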